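{- Let $S$ be the schedule constructed by algorithm PLTR on a feasible instance. For every processor $k\in[m]$ that is not idle in every slot of $S$, there exists a critical set for processor $k$.
   Context: Problem: $m\ge1$ processors numbered $1,\dots,m$; a set $J$ of jobs, each with integer release time $r_j$, deadline $d_j$, processing volume $p_j$; time slots $T=\{0,\dots,d\}$; $E_j=\{t\in T: r_j\le t\le d_j\}$. A feasible schedule assigns to each processor and slot at most one job such that every job $j$ occupies exactly $p_j$ distinct slots of $E_j$ and is never on two processors in the same slot. Algorithm PLTR: initialize $m_t\gets m$, $l_t\gets0$ for all $t$. For $k=m,\dots,1$: $t\gets0$; while $t\le d$: $t\gets\mathrm{KeepIdle}(k,t)$; $t\gets\mathrm{KeepBusy}(k,t)$. $\mathrm{KeepIdle}(k,t)$ finds the maximal $t'>t$ such that a feasible schedule with $l_s\le\#\{\text{busy processors at }s\}\le m_s$ for all $s$ still exists after setting $m_{t''}=k-1$ for $t''\in[t,t')$, applies the update and returns $t'$; $\mathrm{KeepBusy}(k,t)$ does the same with the update $l_{t''}\gets\max\{k,l_{t''}\}$. The output $S$ is a feasible schedule respecting the final bounds, obtained from a maximum flow, with jobs at each slot placed on the lowest-numbered processors. Notation for $S$: $\mathrm{vol}(t)$ is the number of jobs scheduled at $t$, $\mathrm{vol}(Q)=\sum_{t\in Q}\mathrm{vol}(t)$; $\mathrm{fv}(Q)=\sum_j\max\{0,p_j-|E_j\setminus Q|\}$; density $\phi(Q)=\mathrm{fv}(Q)/|Q|$. A busy interval of processor $k$ is an inclusion-maximal interval of slots in which $k$ is busy;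 $t$ is an engagement of $k$ if $t=\min B$ for a busy interval $B$ of $k$. A set $C_k\subseteq T$ is a critical set for processor $k$ if: (i) $C_k\supseteq C_{k'}$ for every critical set $C_{k'}$ for every processor $k'>k$; (ii) every engagement of processor $k$ lies in $C_k$; (iii) $\mathrm{fv}(C_k)=\mathrm{vol}(C_k)$; (iv) $\mathrm{vol}(t)\ge k-1$ for all $t\in C_k$; and (v) $\phi(C_k)$ is maximal among all sets satisfying (i)–(iv). (This is defined recursively for $k=m,m-1,\dots,1$.) -}

module Defs where

open import Data.Nat using (ℕ; _⊔_; zero; suc; _+_; _*_; _∸_; _≤_; _<_; _≤?_; _<?_)
open import Data.Fin using (Fin; toℕ)
open import Data.Fin.Properties using () renaming (_≟_ to _≟ᶠ_)
open import Data.Fin.Subset using (Subset; _∈_; _⊆_; _─_; ∣_∣; Nonempty; outside; inside)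
open import Data.Vec using (tabulate)
open import Data.List using (List; map; allFin; applyUpTo)
open import Data.Nat.ListAction using (sum)
open import Data.Bool.ListAction using (any)
open import Data.Fin.Subset.Properties using (_∈?_)
open import Data.Bool using (Bool; true; false; if_then_else_; _∧_)
open import Data.Maybe using (Maybe; just; nothing; is-just)
open import Data.Product using (Σ; ∃; _×_; _,_)
open import Data.Sum using (_⊎_)
open import Data.Unit using (⊤)
open import Relation.Nullary using (¬_; Dec; yes; no)
open import Relation.Nullary.Decidable using (⌊_⌋)
open import Relation.Binary.PropositionalEquality using (_≡_; _≢_)

-- An instance: m processors (numbered 1..m), slots T = {0,...,d} (as Fin (suc d)),
-- n jobs (indexed by Fin n) with release r j, deadline dl j, volume p j.
record Instance : Set where
  field
    m  : ℕ
    d  : ℕ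
    n  : ℕ
    r  : Fin n → ℕ
    dl : Fin n → ℕ
    p  : Fin n → ℕ

module _ (I : Instance) where
  open Instance I

  Slot : Set
  Slot = Fin (suc d)

  E : Fin n → Subset (suc d)
  E j = tabulate (λ t → if ⌊ r j ≤? toℕ t ⌋ ∧ ⌊ toℕ t ≤? dl j ⌋ then inside else outside)

  -- A schedule: sched k t = job run by processor k at slot t (processors are 1..m;
  -- any other processor number must stay idle, see Feasible).
  Schedule : Set
  Schedule = ℕ → Slot → Maybe (Fin n)

  count : {A : Set} → (A → Bool) → List A → ℕ
  count f xs = sum (map (λ x → if f x then 1 else 0) xs)

  procs : List ℕ
  procs = applyUpTo suc m

  runsAt : Schedule → Fin n → Slot → Bool
  runsAt S j t = any (λ k → isJ (S k t)) procs
    where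
    isJ : Maybe (Fin n) → Bool
    isJ (just j') = ⌊ j' ≟ᶠ j ⌋
    isJ nothing   = false

  occ : Schedule → Fin n → ℕ
  occ S j = count (runsAt S j) (allFin (suc d))

  record Feasible (S : Schedule) : Set where
    field
      inRange  : ∀ k t j → S k t ≡ just j →
                   1 ≤ k × k ≤ m × r j ≤ toℕ t × toℕ t ≤ dl j
      noPar    : ∀ k k' t j → S k t ≡ just j → S k' t ≡ just j → k ≡ k'
      volume   : ∀ j → occ S j ≡ p j

  FeasibleInstance : Set
  FeasibleInstance = Σ Schedule Feasible

  vol : Schedule → Slot → ℕ
  vol S t = count (λ k → is-just (S k t)) procs

  volSet : Schedule → Subset (suc d) → ℕ
  volSet S Q = sum (map (λ t → if ⌊ t ∈? Q ⌋ then vol S t else 0) (allFin (suc d)))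

  fv : Subset (suc d) → ℕ
  fv Q = sum (map (λ j → p j ∸ ∣ E j ─ Q ∣) (allFin n))

  -- Algorithm PLTR, as a relation on bound vectors (m_t, l_t).
  Bounds : Set
  Bounds = (Slot → ℕ) × (Slot → ℕ)   -- (upper m_t , lower l_t)

  BoundsFeasible : Bounds → Set
  BoundsFeasible (mt , lt) =
    Σ Schedule λ S → Feasible S × (∀ t → lt t ≤ vol S t × vol S t ≤ mt t)

  inRangeB : ℕ → ℕ → Slot → Bool
  inRangeB a b s = ⌊ a ≤? toℕ s ⌋ ∧ ⌊ toℕ s <? b ⌋

  updIdle : ℕ → ℕ → ℕ → Bounds → Bounds
  updIdle k t t' (mt , lt) = (λ s → if inRangeB t t' s then k ∸ 1 else mt s) , lt

  updBusy : ℕ → ℕ → ℕ → Bounds → Bounds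
  updBusy k t t' (mt , lt) = mt , (λ s → if inRangeB t t' s then k ⊔ lt s else lt s)

  MaxStep : (ℕ → ℕ → ℕ → Bounds → Bounds) → ℕ → ℕ → Bounds → ℕ → Set
  MaxStep upd k t B t' =
    t ≤ t' × t' ≤ suc d × BoundsFeasible (upd k t t' B) ×
    (∀ t'' → t' < t'' → t'' ≤ suc d → ¬ BoundsFeasible (upd k t t'' B))

  -- while t ≤ d: t ← KeepIdle(k,t); t ← KeepBusy(k,t)
  data Loop (k : ℕ) : ℕ → Bounds → Bounds → Set where
    done : ∀ {t B} → d < t → Loop k t B B
    step : ∀ {t t₁ t₂ B B'} → t ≤ d →
           MaxStep updIdle k t B t₁ →
           MaxStep updBusy k t₁ (updIdle k t t₁ B) t₂ →
           Loop k t₂ (updBusy k t₁ t₂ (updIdle k t t₁ B)) B' →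
           Loop k t B B'

  data Rounds : ℕ → Bounds → Bounds → Set where
    rzero : ∀ {B} → Rounds 0 B B
    rsuc  : ∀ {k B B' B''} → Loop (suc k) 0 B B' → Rounds k B' B'' → Rounds (suc k) B B''

  initBounds : Bounds
  initBounds = (λ _ → m) , (λ _ → 0)

  PLTR : Bounds → Set
  PLTR B = Rounds m initBounds B

  -- The output S: a feasible schedule respecting the final bounds, with the
  -- jobs of each slot on the lowest-numbered processors.
  Output : Bounds → Schedule → Set
  Output (mt , lt) S =
    Feasible S × (∀ t → lt t ≤ vol S t × vol S t ≤ mt t) ×
    (∀ k k' t → 1 ≤ k → k < k' → S k' t ≢ nothing → S k t ≢ nothing)

  module _ (S : Schedule) where

    Busy : ℕ → Slot → Set
    Busy k t = S k t ≢ nothing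

    AllBusy : ℕ → ℕ → ℕ → Set
    AllBusy k a b = ∀ (s : Slot) → a ≤ toℕ s → toℕ s ≤ b → Busy k s

    BusyInterval : ℕ → ℕ → ℕ → Set
    BusyInterval k a b =
      a ≤ b × b ≤ d × AllBusy k a b ×
      (∀ a' b' → a' ≤ a → b ≤ b' → b' ≤ d → AllBusy k a' b' → a' ≡ a × b' ≡ b)

    Engagement : ℕ → Slot → Set
    Engagement k t = ∃ λ b → BusyInterval k (toℕ t) b

    -- density comparison φ(Q) ≤ φ(Q') for nonempty Q, Q'
    DensLe : Subset (suc d) → Subset (suc d) → Set
    DensLe Q Q' = fv Q * ∣ Q' ∣ ≤ fv Q' * ∣ Q ∣

    -- Crit g C : C is a critical set for processor k = m ∸ g.
    mutual
      Cond : ℕ → Subset (suc d) → Set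
      Cond g C =
        Above g C ×
        (∀ t → Engagement (m ∸ g) t → t ∈ C) ×
        fv C ≡ volSet S C ×
        (∀ t → t ∈ C → (m ∸ g) ∸ 1 ≤ vol S t)

      -- (i): C ⊇ C' for every critical set C' of every processor k' > k (gap g' < g)
      Above : ℕ → Subset (suc d) → Set
      Above zero    C = ⊤
      Above (suc g) C = (∀ C' → Crit g C' → C' ⊆ C) × Above g C

      Crit : ℕ → Subset (suc d) → Set
      Crit g C = Cond g C × Nonempty C ×
                 (∀ C' → Cond g C' → Nonempty C' → DensLe C' C)

    CriticalSet : ℕ → Subset (suc d) → Set
    CriticalSet k C = Crit (m ∸ k) C

-- Say that a unit of work of job j at slot x can move to slot y if y ∈ E_j and j is not
-- processed at y, and call a set of slots closed if no work inside it can move outside. For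
-- every set Q one has fv(Q) ≤ vol(Q), with equality exactly when Q is closed. For processor k
-- let C be the set of slots x from which every slot reachable by such moves has vol ≥ k − 1.
-- Then C is closed, hence tight, satisfies (iv), and contains every closed set on which
-- vol ≥ k − 1, in particular every critical set of a processor k′ > k. C also contains every
-- engagement e of k: if a slot y with vol(y) < k − 1 were reachable from e, shifting one unit
-- of work along a path from e to y would give a feasible schedule that respects the bounds of
-- PLTR and has one unit less at e, so the call KeepIdle(vol(e), ·) that stopped at e could have
-- gone one slot further. As k is busy somewhere, C is nonempty, and a densest set among the
-- finitely many sets satisfying (i)–(iv) exists.

module Submission where

open import Defs
open import Data.Bool using (Bool; true; false; if_then_else_; _∧_; not; T)
import Data.Bool.Properties as Boolₚ
open import Data.Empty using (⊥; ⊥-elim)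
open import Data.Fin as Fin using (Fin; toℕ)
import Data.Fin.Properties as Finₚ
open import Data.Fin.Subset using (Subset; _∈_; _∉_; _⊆_; _─_; _∪_; ⁅_⁆; ∣_∣; Nonempty; inside; outside)
import Data.Fin.Subset.Properties as Subₚ
open import Data.List as List using (map; allFin; applyUpTo)
import Data.List.Properties as Listₚ
import Data.List.Relation.Unary.Any.Properties as Anyₚ
open import Data.Maybe using (Maybe; just; nothing; is-just)
import Data.Maybe.Properties as Maybeₚ
open import Data.Nat as ℕ using (ℕ; zero; suc; _+_; _*_; _∸_; _≤_; _<_; _⊓_; _⊔_; z≤n; s≤s; s≤s⁻¹; _<ᵇ_)
open import Data.Nat.GeneralisedArithmetic using (fold)
import Data.Nat.ListAction as ℕL
open import Data.Nat.Properties
open import Data.Product using (∃; _×_; _,_; proj₁; proj₂)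
open import Data.Sum as Sum using (_⊎_; inj₁; inj₂)
open import Data.Vec as Vec using (lookup; tabulate)
import Data.Vec.Properties as Vecₚ
open import Function using (id; _∘_; flip; const; _⇔_; mk⇔; Equivalence)
open import Relation.Binary.Definitions using (Tri; tri<; tri≈; tri>)
open import Relation.Binary.PropositionalEquality
open import Relation.Nullary using (¬_; Dec; yes; no; ¬?; contradiction)
open import Relation.Nullary.Decidable
  using (⌊_⌋; toWitness; fromWitness; T?; map′; _×-dec_; _→-dec_; decidable-stable)

open import Algebra.Properties.CommutativeMonoid.Sum +-0-commutativeMonoid
  using (sum; sum-syntax; ∑-distrib-+; ∑-comm; sum-cong-≗; sum-replicate-zero)
open import Algebra.Properties.CommutativeSemigroup *-commutativeSemigroup using (xy∙z≈xz∙y)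

+-mono-≤-≡ : ∀ {a b c e} → a ≤ b → c ≤ e → a + c ≡ b + e → a ≡ b
+-mono-≤-≡ a≤b c≤e eq with m≤n⇒m<n∨m≡n a≤b
... | inj₁ a<b = contradiction eq (<⇒≢ (+-mono-<-≤ a<b c≤e))
... | inj₂ a≡b = a≡b

+∸<ˡ : ∀ {c o e} → 1 ≤ c → o < e → c + o ∸ e < c
+∸<ˡ {c} {o} {e} 1≤c o<e with e ℕ.≤? c + o
... | yes e≤c+o = subst (c + o ∸ e <_) (m+n∸n≡m c o) (∸-monoʳ-< o<e e≤c+o)
... | no  e≰c+o = subst (_< c) (sym (m≤n⇒m∸n≡0 (<⇒≤ (≰⇒> e≰c+o)))) 1≤c

cross-≤-trans : ∀ {a b c x y z} → 1 ≤ y → a * y ≤ b * x → b * z ≤ c * y → a * z ≤ c * x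
cross-≤-trans {a} {b} {c} {x} {suc y′} {z} _ ay≤bx bz≤cy = *-cancelʳ-≤ (a * z) (c * x) (suc y′) (begin
  a * z * y  ≡⟨ xy∙z≈xz∙y a z y ⟩
  a * y * z  ≤⟨ *-monoˡ-≤ z ay≤bx ⟩
  b * x * z  ≡⟨ xy∙z≈xz∙y b x z ⟩
  b * z * x  ≤⟨ *-monoˡ-≤ x bz≤cy ⟩
  c * y * x  ≡⟨ xy∙z≈xz∙y c y x ⟩
  c * x * y  ∎)
  where
  open ≤-Reasoning
  y = suc y′

T-∧⁻ : ∀ {a b} → T (a ∧ b) → T a × T b
T-∧⁻ = Equivalence.to Boolₚ.T-∧

T-∧⁺ : ∀ {a b} → T a → T b → T (a ∧ b)
T-∧⁺ ta tb = Equivalence.from Boolₚ.T-∧ (ta , tb)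

¬T⇒T-not : ∀ {b} → ¬ T b → T (not b)
¬T⇒T-not {false} _  = _
¬T⇒T-not {true}  ¬b = ¬b _

T-not⇒¬T : ∀ {b} → T (not b) → ¬ T b
T-not⇒¬T {false} _ ()

if-T : ∀ {A : Set} {c} {x y : A} → T c → (if c then x else y) ≡ x
if-T {c = true} _ = refl

if-¬T : ∀ {A : Set} {c} {x y : A} → ¬ T c → (if c then x else y) ≡ y
if-¬T {c = true}  ¬c = contradiction _ ¬c
if-¬T {c = false} _  = refl

is-just⁺ : ∀ {A : Set} {x : Maybe A} → x ≢ nothing → T (is-just x)
is-just⁺ {x = just _}  _  = _
is-just⁺ {x = nothing} ne = ne refl

is-just⁻ : ∀ {A : Set} {x : Maybe A} → T (is-just x) → x ≢ nothing
is-just⁻ {x = just _} _ ()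

𝟙 : Bool → ℕ
𝟙 b = if b then 1 else 0

𝟙-T : ∀ {b} → T b → 𝟙 b ≡ 1
𝟙-T {true} _ = refl

𝟙-¬T : ∀ {b} → ¬ T b → 𝟙 b ≡ 0
𝟙-¬T {true}  ¬b = contradiction _ ¬b
𝟙-¬T {false} _  = refl

𝟙≤1 : ∀ b → 𝟙 b ≤ 1
𝟙≤1 true  = ≤-refl
𝟙≤1 false = z≤n

𝟙-mono : ∀ {a b} → (T a → T b) → 𝟙 a ≤ 𝟙 b
𝟙-mono {false} _   = z≤n
𝟙-mono {true}  a⇒b = ≤-reflexive (sym (𝟙-T (a⇒b _)))

𝟙-cong : ∀ {a b} → (T a → T b) → (T b → T a) → 𝟙 a ≡ 𝟙 b
𝟙-cong a⇒b b⇒a = ≤-antisym (𝟙-mono a⇒b) (𝟙-mono b⇒a)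

-- Finite sums

sum-zero : ∀ {n} {f : Fin n → ℕ} → (∀ i → f i ≡ 0) → sum f ≡ 0
sum-zero {n} f≗0 = trans (sum-cong-≗ f≗0) (sum-replicate-zero n)

sum-mono-≤ : ∀ {n} {f g : Fin n → ℕ} → (∀ i → f i ≤ g i) → sum f ≤ sum g
sum-mono-≤ {zero}  _   = z≤n
sum-mono-≤ {suc n} f≤g = +-mono-≤ (f≤g Fin.zero) (sum-mono-≤ (f≤g ∘ Fin.suc))

sum-≡⇒≗ : ∀ {n} {f g : Fin n → ℕ} → (∀ i → f i ≤ g i) → sum f ≡ sum g → ∀ i → f i ≡ g i
sum-≡⇒≗ f≤g eq Fin.zero    = +-mono-≤-≡ (f≤g Fin.zero) (sum-mono-≤ (f≤g ∘ Fin.suc)) eq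
sum-≡⇒≗ f≤g eq (Fin.suc i) = sum-≡⇒≗ (f≤g ∘ Fin.suc) (+-cancelˡ-≡ _ _ _ eq′) i
  where eq′ = trans (cong (_+ _) (sym (sum-≡⇒≗ f≤g eq Fin.zero))) eq

sum-mono-< : ∀ {n} {f g : Fin n → ℕ} → (∀ i → f i ≤ g i) → ∀ i → f i < g i → sum f < sum g
sum-mono-< f≤g i fi<gi = ≤∧≢⇒< (sum-mono-≤ f≤g) λ eq → <⇒≢ fi<gi (sum-≡⇒≗ f≤g eq i)

term≤sum : ∀ {n} (f : Fin n → ℕ) i → f i ≤ sum f
term≤sum f Fin.zero    = m≤m+n _ _
term≤sum f (Fin.suc i) = ≤-trans (term≤sum (f ∘ Fin.suc) i) (m≤n+m _ _)

∑-+-cong : ∀ {n} {f g f′ g′ : Fin n → ℕ} → (∀ i → f i + g i ≡ f′ i + g′ i) →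
           sum f + sum g ≡ sum f′ + sum g′
∑-+-cong {f = f} {g} {f′} {g′} eq =
  trans (sym (∑-distrib-+ f g)) (trans (sum-cong-≗ eq) (∑-distrib-+ f′ g′))

sum-𝟙≤ : ∀ {n} (b : Fin n → Bool) → ∑[ i < n ] 𝟙 (b i) ≤ n
sum-𝟙≤ {zero}  b = z≤n
sum-𝟙≤ {suc n} b = +-mono-≤ (𝟙≤1 (b Fin.zero)) (sum-𝟙≤ (b ∘ Fin.suc))

sum-𝟙-<ᵇ : ∀ n k → ∑[ i < n ] 𝟙 (toℕ i <ᵇ k) ≡ n ⊓ k
sum-𝟙-<ᵇ zero    k       = refl
sum-𝟙-<ᵇ (suc n) zero    = sum-zero {n} (λ _ → refl)
sum-𝟙-<ᵇ (suc n) (suc k) = cong suc (sum-𝟙-<ᵇ n k)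

sum-𝟙-singleton : ∀ {n} (b : Fin n → Bool) a → (∀ i → T (b i) → i ≡ a) → ∑[ i < n ] 𝟙 (b i) ≡ 𝟙 (b a)
sum-𝟙-singleton b Fin.zero only =
  trans (cong (𝟙 (b Fin.zero) +_) (sum-zero λ i → 𝟙-¬T λ bi → Finₚ.0≢1+n (sym (only (Fin.suc i) bi))))
        (+-identityʳ _)
sum-𝟙-singleton b (Fin.suc a) only =
  trans (cong (_+ ∑[ i < _ ] 𝟙 (b (Fin.suc i))) (𝟙-¬T λ b₀ → Finₚ.0≢1+n (only Fin.zero b₀)))
        (sum-𝟙-singleton (b ∘ Fin.suc) a λ i bi → Finₚ.suc-injective (only (Fin.suc i) bi))

sum-𝟙-×-dec : ∀ {n a b} {A : Set a} {P : Fin n → Set b} (c : Dec A) (d : ∀ i → Dec (P i)) i₀ →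
              P i₀ → (∀ i → P i → i ≡ i₀) → ∑[ i < n ] 𝟙 ⌊ c ×-dec d i ⌋ ≡ 𝟙 ⌊ c ⌋
sum-𝟙-×-dec c d i₀ Pi₀ only = trans
  (sum-𝟙-singleton (λ i → ⌊ c ×-dec d i ⌋) i₀ λ i h → only i (proj₂ (toWitness h)))
  (at-i₀ c (d i₀))
  where
  at-i₀ : ∀ c d → 𝟙 ⌊ c ×-dec d ⌋ ≡ 𝟙 ⌊ c ⌋
  at-i₀ (yes _) (yes _)  = refl
  at-i₀ (yes _) (no ¬P)  = contradiction Pi₀ ¬P
  at-i₀ (no _)  _        = refl

sum-map-applyUpTo : ∀ (f g : ℕ → ℕ) n → ℕL.sum (map f (applyUpTo g n)) ≡ ∑[ i < n ] f (g (toℕ i))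
sum-map-applyUpTo f g zero    = refl
sum-map-applyUpTo f g (suc n) = cong (f (g 0) +_) (sum-map-applyUpTo f (g ∘ suc) n)

sum-map-allFin : ∀ {n} (f : Fin n → ℕ) → ℕL.sum (map f (allFin n)) ≡ sum f
sum-map-allFin {n} f = trans (cong ℕL.sum (Listₚ.map-tabulate (λ i → i) f)) (go f)
  where
  go : ∀ {n} (f : Fin n → ℕ) → ℕL.sum (List.tabulate f) ≡ sum f
  go {zero}  f = refl
  go {suc n} f = cong (f Fin.zero +_) (go (f ∘ Fin.suc))

∈⇒T : ∀ {n} {x : Fin n} {p : Subset n} → x ∈ p → T (lookup p x)
∈⇒T = Equivalence.from Boolₚ.T-≡ ∘ Vecₚ.[]=⇒lookup

T⇒∈ : ∀ {n} {x : Fin n} {p : Subset n} → T (lookup p x) → x ∈ p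
T⇒∈ {x = x} {p} = Vecₚ.lookup⇒[]= x p ∘ Equivalence.to Boolₚ.T-≡

∈?≡lookup : ∀ {n} (x : Fin n) (p : Subset n) → ⌊ x Subₚ.∈? p ⌋ ≡ lookup p x
∈?≡lookup x p with x Subₚ.∈? p
... | yes x∈p = sym (Vecₚ.[]=⇒lookup x∈p)
... | no  x∉p = sym (Boolₚ.¬-not (x∉p ∘ Vecₚ.lookup⇒[]= x p))

lookup-─ : ∀ {n} (p q : Subset n) i → lookup (p ─ q) i ≡ lookup p i ∧ not (lookup q i)
lookup-─ (x Vec.∷ _) (true  Vec.∷ _) Fin.zero    = sym (Boolₚ.∧-zeroʳ x)
lookup-─ (x Vec.∷ _) (false Vec.∷ _) Fin.zero    = sym (Boolₚ.∧-identityʳ x)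
lookup-─ (_ Vec.∷ p) (_     Vec.∷ q) (Fin.suc i) = lookup-─ p q i

∣∣≡∑ : ∀ {n} (p : Subset n) → ∣ p ∣ ≡ ∑[ i < n ] 𝟙 (lookup p i)
∣∣≡∑ Vec.[]            = refl
∣∣≡∑ (true  Vec.∷ p) = cong suc (∣∣≡∑ p)
∣∣≡∑ (false Vec.∷ p) = ∣∣≡∑ p

nonempty⇒1≤∣∣ : ∀ {n} {p : Subset n} → Nonempty p → 1 ≤ ∣ p ∣
nonempty⇒1≤∣∣ {p = p} (x , x∈p) =
  ≤-trans (≤-reflexive (sym (𝟙-T (∈⇒T x∈p))))
          (≤-trans (term≤sum (λ i → 𝟙 (lookup p i)) x) (≤-reflexive (sym (∣∣≡∑ p))))

⊆∧⊈⇒∣∣< : ∀ {N} {p q : Subset N} → p ⊆ q → ¬ q ⊆ p → ∣ p ∣ < ∣ q ∣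
⊆∧⊈⇒∣∣< {N} {p} {q} p⊆q q⊈p =
  let x , x∉ = Finₚ.¬∀⟶∃¬ N _ (λ x → x Subₚ.∈? q →-dec x Subₚ.∈? p) λ all → q⊈p (all _)
  in Subₚ.p⊂q⇒∣p∣<∣q∣ (p⊆q , x , decidable-stable (x Subₚ.∈? q) (x∉ ∘ flip contradiction) , x∉ ∘ const)

allSubsets? : ∀ {N} {P : Subset N → Set} → (∀ C → Dec (P C)) → Dec (∀ C → P C)
allSubsets? P? with Subₚ.anySubset? (¬? ∘ P?)
... | yes (C , ¬PC) = no λ all → ¬PC (all C)
... | no  none      = yes λ C → decidable-stable (P? C) λ ¬PC → none (C , ¬PC)

Maximum : ∀ {N} → (Subset N → Set) → (Subset N → Subset N → Set) → Set
Maximum P _≼_ = ∃ λ C → P C × ∀ C′ → P C′ → C′ ≼ C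

maximum-or-empty : ∀ {N} {P : Subset N → Set} {_≼_ : Subset N → Subset N → Set} → (∀ C → Dec (P C)) →
                   (∀ {C C′} → P C → P C′ → C ≼ C′ ⊎ C′ ≼ C) →
                   (∀ {C C′ C″} → P C′ → C ≼ C′ → C′ ≼ C″ → C ≼ C″) →
                   Maximum P _≼_ ⊎ (∀ C → ¬ P C)
maximum-or-empty {zero} P? total _ with P? Vec.[]
... | yes p = inj₁ (Vec.[] , p , λ { Vec.[] _ → Sum.[ id , id ] (total p p) })
... | no ¬p = inj₂ λ { Vec.[] → ¬p }
maximum-or-empty {suc N} {P} {_≼_} P? total trans′ = combine (half inside) (half outside)
  where
  Half : Bool → Set
  Half b = Maximum (P ∘ (b Vec.∷_)) (λ C C′ → (b Vec.∷ C) ≼ (b Vec.∷ C′)) ⊎ (∀ C → ¬ P (b Vec.∷ C))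
  half : ∀ b → Half b
  half b = maximum-or-empty (P? ∘ (b Vec.∷_)) total trans′
  combine : Half inside → Half outside → Maximum P _≼_ ⊎ (∀ C → ¬ P C)
  combine (inj₁ (Cᵢ , pᵢ , maxᵢ)) (inj₁ (Cₒ , pₒ , maxₒ)) with total pᵢ pₒ
  ... | inj₁ i≼o = inj₁ (outside Vec.∷ Cₒ , pₒ , λ { (true Vec.∷ C) p → trans′ pᵢ (maxᵢ C p) i≼o
                                                    ; (false Vec.∷ C) p → maxₒ C p })
  ... | inj₂ o≼i = inj₁ (inside Vec.∷ Cᵢ , pᵢ , λ { (true Vec.∷ C) p → maxᵢ C p
                                                   ; (false Vec.∷ C) p → trans′ pₒ (maxₒ C p) o≼i })
  combine (inj₁ (Cᵢ , pᵢ , maxᵢ)) (inj₂ noneₒ) =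
    inj₁ (inside Vec.∷ Cᵢ , pᵢ , λ { (true Vec.∷ C) p → maxᵢ C p
                                  ; (false Vec.∷ C) p → contradiction p (noneₒ C) })
  combine (inj₂ noneᵢ) (inj₁ (Cₒ , pₒ , maxₒ)) =
    inj₁ (outside Vec.∷ Cₒ , pₒ , λ { (true Vec.∷ C) p → contradiction p (noneᵢ C)
                                   ; (false Vec.∷ C) p → maxₒ C p })
  combine (inj₂ noneᵢ) (inj₂ noneₒ) = inj₂ λ { (true Vec.∷ C) → noneᵢ C ; (false Vec.∷ C) → noneₒ C }

-- Reachability in a finite digraph

fold-stable-or-growing : ∀ {N} (F : Subset N → Subset N) → (∀ {Q} → Q ⊆ F Q) → ∀ Q i →
                         F (fold Q F i) ⊆ fold Q F i ⊎ i < ∣ fold Q F (suc i) ∣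
fold-stable-or-growing F inflate Q zero with F Q Subₚ.⊆? Q
... | yes fixed = inj₁ fixed
... | no  grows = inj₂ (≤-trans (s≤s z≤n) (⊆∧⊈⇒∣∣< inflate grows))
fold-stable-or-growing F inflate Q (suc i)
  with fold-stable-or-growing F inflate Q i | F (fold Q F (suc i)) Subₚ.⊆? fold Q F (suc i)
... | _          | yes fixed = inj₁ fixed
... | inj₁ fixed | no  grows = ⊥-elim (grows (subst (λ P → F P ⊆ P) (sym (Subₚ.⊆-antisym fixed inflate)) fixed))
... | inj₂ i<∣∣  | no  grows = inj₂ (≤-<-trans i<∣∣ (⊆∧⊈⇒∣∣< inflate grows))

fold-stable : ∀ {N} (F : Subset N → Subset N) → (∀ {Q} → Q ⊆ F Q) → ∀ Q → F (fold Q F N) ⊆ fold Q F N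
fold-stable {N} F inflate Q with fold-stable-or-growing F inflate Q N
... | inj₁ fixed = fixed
... | inj₂ N<∣∣  = contradiction (Subₚ.∣p∣≤n (fold Q F (suc N))) (<⇒≱ N<∣∣)

module Reachability {N} (_⇝_ : Fin N → Fin N → Set) (_⇝?_ : ∀ x y → Dec (x ⇝ y)) where

  Closed : Subset N → Set
  Closed Q = ∀ {x y} → x ∈ Q → x ⇝ y → y ∈ Q

  -- Opaque, so that with-abstractions over membership in a layer do not unfold the iteration.
  opaque
    successors : Subset N → Subset N
    successors Q = tabulate λ y → ⌊ Finₚ.any? (λ x → x Subₚ.∈? Q ×-dec x ⇝? y) ⌋

    ∈successors⁻ : ∀ {Q y} → y ∈ successors Q → ∃ λ x → x ∈ Q × x ⇝ y
    ∈successors⁻ {Q} {y} y∈ = toWitness (subst T (Vecₚ.lookup∘tabulate _ y) (∈⇒T y∈))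

    ∈successors⁺ : ∀ {Q x y} → x ∈ Q → x ⇝ y → y ∈ successors Q
    ∈successors⁺ {Q} {x} {y} x∈Q x⇝y = T⇒∈ (subst T (sym (Vecₚ.lookup∘tabulate _ y)) (fromWitness (x , x∈Q , x⇝y)))

    layer : Fin N → ℕ → Subset N
    layer x i = fold ⁅ x ⁆ (λ Q → Q ∪ successors Q) i

  reach : Fin N → Subset N
  reach x = layer x N

  opaque
    unfolding layer

    layer-⊆-suc : ∀ {x i} → layer x i ⊆ layer x (suc i)
    layer-⊆-suc = Subₚ.p⊆p∪q _

    layer-zero⁻ : ∀ {x y} → y ∈ layer x 0 → y ≡ x
    layer-zero⁻ = Subₚ.x∈⁅y⁆⇒x≡y _

    layer-suc⁻ : ∀ {x y i} → y ∈ layer x (suc i) → y ∈ layer x i ⊎ ∃ λ z → z ∈ layer x i × z ⇝ y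
    layer-suc⁻ {x} {y} {i} y∈ = Sum.map₂ ∈successors⁻ (Subₚ.x∈p∪q⁻ (layer x i) _ y∈)

    x∈reach : ∀ x → x ∈ reach x
    x∈reach x = go N
      where
      go : ∀ i → x ∈ layer x i
      go zero    = Subₚ.x∈⁅x⁆ x
      go (suc i) = layer-⊆-suc {x} {i} (go i)

    reach-closed : ∀ x → Closed (reach x)
    reach-closed x z∈ z⇝y = fold-stable _ (Subₚ.p⊆p∪q _) ⁅ x ⁆ (Subₚ.q⊆p∪q _ _ (∈successors⁺ z∈ z⇝y))

    reach-least : ∀ {Q x} → Closed Q → x ∈ Q → reach x ⊆ Q
    reach-least {Q} {x} closed x∈Q = go N
      where
      go : ∀ i → layer x i ⊆ Q
      go zero    y∈ = subst (_∈ Q) (sym (layer-zero⁻ {x} y∈)) x∈Q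
      go (suc i) {y} y∈ with layer-suc⁻ {x} {y} {i} y∈
      ... | inj₁ y∈layer      = go i y∈layer
      ... | inj₂ (z , z∈ , z⇝y) = closed (go i z∈) z⇝y

-- Schedules

module _ (I : Instance) where
  open Instance I

  proc : Fin m → ℕ
  proc i = suc (toℕ i)

  vol≡∑ : ∀ S t → vol I S t ≡ ∑[ i < m ] 𝟙 (is-just (S (proc i) t))
  vol≡∑ S t = sum-map-applyUpTo (λ k → 𝟙 (is-just (S k t))) suc m

  occ≡∑ : ∀ S j → occ I S j ≡ ∑[ t < suc d ] 𝟙 (runsAt I S j t)
  occ≡∑ S j = sum-map-allFin (λ t → 𝟙 (runsAt I S j t))

  -- The per-processor test inside runsAt is local to Defs and cannot be named, so both directions
  -- reach it by with-abstraction over S k t.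
  runs⇒ : ∀ {S j t} → T (runsAt I S j t) → ∃ λ k → S k t ≡ just j
  runs⇒ {S} {j} {t} h with Anyₚ.applyUpTo⁻ suc (Anyₚ.any⁻ _ (procs I) h)
  ... | k , _ , hk with S (suc k) t in eq
  ... | just j′ = suc k , trans eq (cong just (toWitness hk))

  runs⇐ : ∀ {S j t k} → 1 ≤ k → k ≤ m → S k t ≡ just j → T (runsAt I S j t)
  runs⇐ {S} {j} {t} {suc k} _ k<m eq with T? (runsAt I S j t)
  ... | yes r = r
  ... | no ¬r with S (suc k) t | eq | (λ y → ¬r (Anyₚ.any⁺ _ (Anyₚ.applyUpTo⁺ suc y k<m)))
  ... | _ | refl | ¬y = contradiction (fromWitness refl) ¬y

  proc-injective : ∀ {i i′} → proc i ≡ proc i′ → i ≡ i′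
  proc-injective = Finₚ.toℕ-injective ∘ suc-injective

  proc-surjective : ∀ {k} → 1 ≤ k → k ≤ m → ∃ λ a → proc a ≡ k
  proc-surjective {suc k} _ k<m = Fin.fromℕ< k<m , cong suc (Finₚ.toℕ-fromℕ< k<m)

  lookup-E : ∀ j t → lookup (E I j) t ≡ (⌊ r j ℕ.≤? toℕ t ⌋ ∧ ⌊ toℕ t ℕ.≤? dl j ⌋)
  lookup-E j t with r j ℕ.≤? toℕ t | toℕ t ℕ.≤? dl j | Vecₚ.lookup∘tabulate
    (λ t → if ⌊ r j ℕ.≤? toℕ t ⌋ ∧ ⌊ toℕ t ℕ.≤? dl j ⌋ then inside else outside) t
  ... | yes _ | yes _ | eq = eq
  ... | yes _ | no _  | eq = eq
  ... | no _  | _     | eq = eq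

  ∈E⇔ : ∀ {j t} → t ∈ E I j ⇔ (r j ≤ toℕ t × toℕ t ≤ dl j)
  ∈E⇔ {j} {t} = mk⇔ to from
    where
    to : t ∈ E I j → r j ≤ toℕ t × toℕ t ≤ dl j
    to t∈E with r j ℕ.≤? toℕ t | toℕ t ℕ.≤? dl j | subst T (lookup-E j t) (∈⇒T t∈E)
    ... | yes a | yes b | _ = a , b
    from : r j ≤ toℕ t × toℕ t ≤ dl j → t ∈ E I j
    from (a , b) with r j ℕ.≤? toℕ t | toℕ t ℕ.≤? dl j | lookup-E j t
    ... | yes _ | yes _ | eq = T⇒∈ (subst T (sym eq) _)
    ... | no ¬a | _     | _  = contradiction a ¬a
    ... | yes _ | no ¬b | _  = contradiction b ¬b

  isJob : Fin n → Maybe (Fin n) → Bool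
  isJob j x = ⌊ Maybeₚ.≡-dec Finₚ._≟_ x (just j) ⌋

  ∑-isJob : ∀ x → ∑[ j < n ] 𝟙 (isJob j x) ≡ 𝟙 (is-just x)
  ∑-isJob nothing   = sum-zero {n} λ _ → refl
  ∑-isJob (just j′) = trans
    (sum-𝟙-singleton (λ j → isJob j (just j′)) j′ λ j h → sym (Maybeₚ.just-injective (toWitness h)))
    (𝟙-T (fromWitness refl))

  module _ (S : Schedule I) where

    Step : Slot I → Slot I → Set
    Step x y = ∃ λ j → T (runsAt I S j x) × y ∈ E I j × ¬ T (runsAt I S j y)

    step? : ∀ x y → Dec (Step x y)
    step? x y = Finₚ.any? λ j → T? (runsAt I S j x) ×-dec y Subₚ.∈? E I j ×-dec ¬? (T? (runsAt I S j y))

    open Reachability Step step? public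

    module _ (fs : Feasible I S) where
      open Feasible fs

      runs⇐ᶠ : ∀ {j t k} → S k t ≡ just j → T (runsAt I S j t)
      runs⇐ᶠ eq = let k≥1 , k≤m , _ = inRange _ _ _ eq in runs⇐ {S} k≥1 k≤m eq

      runs⇒E : ∀ {j t} → T (runsAt I S j t) → t ∈ E I j
      runs⇒E {j} {t} h = let k , eq = runs⇒ {S} h ; _ , _ , bounds = inRange k t j eq in Equivalence.from ∈E⇔ bounds

      ∑-procs-isJob : ∀ j t → ∑[ i < m ] 𝟙 (isJob j (S (proc i) t)) ≡ 𝟙 (runsAt I S j t)
      ∑-procs-isJob j t with T? (runsAt I S j t)
      ... | no ¬r = trans (sum-zero {m} λ i → 𝟙-¬T λ h → ¬r (runs⇐ᶠ (toWitness h))) (sym (𝟙-¬T ¬r))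
      ... | yes r with runs⇒ {S} r
      ... | k , eq with proc-surjective (proj₁ (inRange k t j eq)) (proj₁ (proj₂ (inRange k t j eq)))
      ... | a , refl = trans
        (sum-𝟙-singleton _ a λ i h → proc-injective (noPar _ _ t j (toWitness h) eq))
        (trans (𝟙-T (fromWitness eq)) (sym (𝟙-T r)))

      vol≡∑runs : ∀ t → vol I S t ≡ ∑[ j < n ] 𝟙 (runsAt I S j t)
      vol≡∑runs t = begin
        vol I S t                                           ≡⟨ vol≡∑ S t ⟩
        ∑[ i < m ] 𝟙 (is-just (S (proc i) t))               ≡⟨ sum-cong-≗ (λ i → sym (∑-isJob (S (proc i) t))) ⟩
        ∑[ i < m ] ∑[ j < n ] 𝟙 (isJob j (S (proc i) t))    ≡⟨ ∑-comm (λ i j → 𝟙 (isJob j (S (proc i) t))) ⟩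
        ∑[ j < n ] ∑[ i < m ] 𝟙 (isJob j (S (proc i) t))    ≡⟨ sum-cong-≗ (λ j → ∑-procs-isJob j t) ⟩
        ∑[ j < n ] 𝟙 (runsAt I S j t)                       ∎
        where open ≡-Reasoning

      workIn workOut free : Subset (suc d) → Fin n → ℕ
      workIn  Q j = ∑[ t < suc d ] 𝟙 (lookup Q t ∧ runsAt I S j t)
      workOut Q j = ∑[ t < suc d ] 𝟙 (not (lookup Q t) ∧ runsAt I S j t)
      free    Q j = ∑[ t < suc d ] 𝟙 (lookup (E I j) t ∧ not (lookup Q t))

      volSet≡∑workIn : ∀ Q → volSet I S Q ≡ ∑[ j < n ] workIn Q j
      volSet≡∑workIn Q = begin
        volSet I S Q
          ≡⟨ sum-map-allFin (λ t → if ⌊ t Subₚ.∈? Q ⌋ then vol I S t else 0) ⟩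
        ∑[ t < suc d ] (if ⌊ t Subₚ.∈? Q ⌋ then vol I S t else 0)
          ≡⟨ sum-cong-≗ slot ⟩
        ∑[ t < suc d ] ∑[ j < n ] 𝟙 (lookup Q t ∧ runsAt I S j t)
          ≡⟨ ∑-comm (λ t j → 𝟙 (lookup Q t ∧ runsAt I S j t)) ⟩
        ∑[ j < n ] workIn Q j ∎
        where
        open ≡-Reasoning
        slot : ∀ t → (if ⌊ t Subₚ.∈? Q ⌋ then vol I S t else 0) ≡ ∑[ j < n ] 𝟙 (lookup Q t ∧ runsAt I S j t)
        slot t rewrite ∈?≡lookup t Q with lookup Q t
        ... | true  = vol≡∑runs t
        ... | false = sym (sum-zero {n} λ _ → refl)

      fv≡∑ : ∀ Q → fv I Q ≡ ∑[ j < n ] (p j ∸ free Q j)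
      fv≡∑ Q = trans (sum-map-allFin (λ j → p j ∸ ∣ E I j ─ Q ∣)) (sum-cong-≗ λ j → cong (p j ∸_)
        (trans (∣∣≡∑ (E I j ─ Q)) (sum-cong-≗ λ t → cong 𝟙 (lookup-─ (E I j) Q t))))

      p≡workIn+workOut : ∀ Q j → p j ≡ workIn Q j + workOut Q j
      p≡workIn+workOut Q j = begin
        p j                                   ≡⟨ sym (volume j) ⟩
        occ I S j                             ≡⟨ occ≡∑ S j ⟩
        ∑[ t < suc d ] 𝟙 (runsAt I S j t)     ≡⟨ sum-cong-≗ split ⟩
        ∑[ t < suc d ] (𝟙 (lookup Q t ∧ runsAt I S j t) + 𝟙 (not (lookup Q t) ∧ runsAt I S j t))
          ≡⟨ ∑-distrib-+ (λ t → 𝟙 (lookup Q t ∧ runsAt I S j t)) (λ t → 𝟙 (not (lookup Q t) ∧ runsAt I S j t)) ⟩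
        workIn Q j + workOut Q j              ∎
        where
        open ≡-Reasoning
        split : ∀ t → 𝟙 (runsAt I S j t) ≡ 𝟙 (lookup Q t ∧ runsAt I S j t) + 𝟙 (not (lookup Q t) ∧ runsAt I S j t)
        split t with lookup Q t
        ... | true  = sym (+-identityʳ _)
        ... | false = refl

      runs-outside⇒free : ∀ {Q j t} → T (not (lookup Q t) ∧ runsAt I S j t) → T (lookup (E I j) t ∧ not (lookup Q t))
      runs-outside⇒free h = let ∉Q , r = T-∧⁻ h in T-∧⁺ (∈⇒T (runs⇒E r)) ∉Q

      workOut≤free-at : ∀ Q j t → 𝟙 (not (lookup Q t) ∧ runsAt I S j t) ≤ 𝟙 (lookup (E I j) t ∧ not (lookup Q t))
      workOut≤free-at Q j t = 𝟙-mono (runs-outside⇒free {Q} {j} {t})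

      workOut≤free : ∀ Q j → workOut Q j ≤ free Q j
      workOut≤free Q j = sum-mono-≤ (workOut≤free-at Q j)

      p∸free≤workIn : ∀ Q j → p j ∸ free Q j ≤ workIn Q j
      p∸free≤workIn Q j = begin
        p j ∸ free Q j                     ≡⟨ cong (_∸ free Q j) (p≡workIn+workOut Q j) ⟩
        workIn Q j + workOut Q j ∸ free Q j ≤⟨ ∸-monoˡ-≤ (free Q j) (+-monoʳ-≤ (workIn Q j) (workOut≤free Q j)) ⟩
        workIn Q j + free Q j ∸ free Q j    ≡⟨ m+n∸n≡m (workIn Q j) (free Q j) ⟩
        workIn Q j                          ∎
        where open ≤-Reasoning

      -- Job by job, p j ∸ free Q j ≤ workIn Q j, with equality iff j is processed nowhere in Q or at
      -- every slot of E j outside Q.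
      closed⇒tight : ∀ {Q} → Closed Q → fv I Q ≡ volSet I S Q
      closed⇒tight {Q} closed = trans (fv≡∑ Q) (trans (sum-cong-≗ job) (sym (volSet≡∑workIn Q)))
        where
        job : ∀ j → p j ∸ free Q j ≡ workIn Q j
        job j with Finₚ.any? (λ x → x Subₚ.∈? Q ×-dec T? (runsAt I S j x))
        ... | yes (x , x∈Q , rx) = begin
            p j ∸ free Q j                         ≡⟨ cong₂ _∸_ (p≡workIn+workOut Q j) (sym workOut≡free) ⟩
            workIn Q j + workOut Q j ∸ workOut Q j ≡⟨ m+n∸n≡m (workIn Q j) (workOut Q j) ⟩
            workIn Q j                             ∎
          where
          open ≡-Reasoning
          runs-at-free : ∀ {t} → t ∈ E I j → ¬ T (lookup Q t) → T (runsAt I S j t)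
          runs-at-free {t} t∈E t∉Q = decidable-stable (T? _) λ ¬rt → t∉Q (∈⇒T (closed x∈Q (j , rx , t∈E , ¬rt)))
          workOut≡free : workOut Q j ≡ free Q j
          workOut≡free = sum-cong-≗ λ t → 𝟙-cong (runs-outside⇒free {Q} {j} {t})
            λ h → let t∈E , ∉Q = T-∧⁻ h in T-∧⁺ ∉Q (runs-at-free (T⇒∈ t∈E) (T-not⇒¬T ∉Q))
        ... | no nowhere = trans (m≤n⇒m∸n≡0 p≤free) (sym workIn≡0)
          where
          workIn≡0 : workIn Q j ≡ 0
          workIn≡0 = sum-zero λ t → 𝟙-¬T λ h → let t∈Q , r = T-∧⁻ h in nowhere (t , T⇒∈ t∈Q , r)
          p≤free : p j ≤ free Q j
          p≤free = ≤-trans (≤-reflexive (trans (p≡workIn+workOut Q j) (cong (_+ workOut Q j) workIn≡0)))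
                           (workOut≤free Q j)

      tight⇒closed : ∀ {Q} → fv I Q ≡ volSet I S Q → Closed Q
      tight⇒closed {Q} tight {x} {y} x∈Q (j , rx , y∈E , ¬ry) with y Subₚ.∈? Q
      ... | yes y∈Q = y∈Q
      ... | no  y∉Q = contradiction job (<⇒≢ job<)
        where
        job : p j ∸ free Q j ≡ workIn Q j
        job = sum-≡⇒≗ (p∸free≤workIn Q) (trans (sym (fv≡∑ Q)) (trans tight (volSet≡∑workIn Q))) j
        1≤workIn : 1 ≤ workIn Q j
        1≤workIn = ≤-trans (𝟙-mono {true} λ _ → T-∧⁺ (∈⇒T x∈Q) rx)
                           (term≤sum (λ t → 𝟙 (lookup Q t ∧ runsAt I S j t)) x)
        workOut<free : workOut Q j < free Q j
        workOut<free = sum-mono-< (workOut≤free-at Q j) y (begin-strict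
          𝟙 (not (lookup Q y) ∧ runsAt I S j y) ≡⟨ 𝟙-¬T (¬ry ∘ proj₂ ∘ T-∧⁻) ⟩
          0                                     <⟨ ≤-refl ⟩
          1                                     ≡⟨ sym (𝟙-T (T-∧⁺ (∈⇒T y∈E) (¬T⇒T-not (y∉Q ∘ T⇒∈)))) ⟩
          𝟙 (lookup (E I j) y ∧ not (lookup Q y)) ∎)
          where open ≤-Reasoning
        job< : p j ∸ free Q j < workIn Q j
        job< = subst (λ z → z ∸ free Q j < workIn Q j) (sym (p≡workIn+workOut Q j)) (+∸<ˡ 1≤workIn workOut<free)

  -- Moving one unit of work

  move : Schedule I → Fin n → ℕ → Slot I → ℕ → Slot I → Schedule I
  move S j q a q′ b k t with (t Finₚ.≟ a) ×-dec (k ℕ.≟ q) | (t Finₚ.≟ b) ×-dec (k ℕ.≟ q′)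
  ... | yes _ | _     = nothing
  ... | no _  | yes _ = just j
  ... | no _  | no _  = S k t

  module Move {S : Schedule I} (fs : Feasible I S) {j q a q′ b}
    (S[q,a]≡j : S q a ≡ just j) (b∈E : b ∈ E I j) (¬runs-b : ¬ T (runsAt I S j b))
    (1≤q′ : 1 ≤ q′) (q′≤m : q′ ≤ m) (S[q′,b]≡nothing : S q′ b ≡ nothing) where

    open Feasible fs

    S′ : Schedule I
    S′ = move S j q a q′ b

    a≢b : a ≢ b
    a≢b refl = ¬runs-b (runs⇐ᶠ S fs S[q,a]≡j)

    move-at-source : S′ q a ≡ nothing
    move-at-source with (a Finₚ.≟ a) ×-dec (q ℕ.≟ q)
    ... | yes _ = refl
    ... | no ¬eq = contradiction (refl , refl) ¬eq

    move-inv : ∀ {k t j′} → S′ k t ≡ just j′ →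
               (t ≡ b × k ≡ q′ × j′ ≡ j) ⊎ (¬ (t ≡ a × k ≡ q) × S k t ≡ just j′)
    move-inv {k} {t} eq with (t Finₚ.≟ a) ×-dec (k ℕ.≟ q) | (t Finₚ.≟ b) ×-dec (k ℕ.≟ q′) | eq
    ... | no _   | yes (t≡b , k≡q′) | refl = inj₁ (t≡b , k≡q′ , refl)
    ... | no ¬src | no _            | eq′  = inj₂ (¬src , eq′)

    move-preserves : ∀ {k t j′} → S k t ≡ just j′ → ¬ (t ≡ a × j′ ≡ j) → S′ k t ≡ just j′
    move-preserves {k} {t} eq ¬ja with (t Finₚ.≟ a) ×-dec (k ℕ.≟ q) | (t Finₚ.≟ b) ×-dec (k ℕ.≟ q′)
    ... | yes (refl , refl) | _                 = contradiction (refl , Maybeₚ.just-injective (trans (sym eq) S[q,a]≡j)) ¬ja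
    ... | no _              | yes (refl , refl) = contradiction (trans (sym eq) S[q′,b]≡nothing) λ ()
    ... | no _              | no _              = eq

    inRange′ : ∀ k t j′ → S′ k t ≡ just j′ → 1 ≤ k × k ≤ m × r j′ ≤ toℕ t × toℕ t ≤ dl j′
    inRange′ k t j′ eq with move-inv {k} {t} {j′} eq
    ... | inj₁ (refl , refl , refl) = 1≤q′ , q′≤m , Equivalence.to ∈E⇔ b∈E
    ... | inj₂ (_ , eq′)            = inRange k t j′ eq′

    noPar′ : ∀ k k′ t j′ → S′ k t ≡ just j′ → S′ k′ t ≡ just j′ → k ≡ k′
    noPar′ k k′ t j′ eq eq′ with move-inv {k} {t} {j′} eq | move-inv {k′} {t} {j′} eq′
    ... | inj₁ (_ , k≡q′ , _)    | inj₁ (_ , k′≡q′ , _)    = trans k≡q′ (sym k′≡q′)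
    ... | inj₁ (refl , _ , refl) | inj₂ (_ , eq″)          = contradiction (runs⇐ᶠ S fs eq″) ¬runs-b
    ... | inj₂ (_ , eq″)          | inj₁ (refl , _ , refl) = contradiction (runs⇐ᶠ S fs eq″) ¬runs-b
    ... | inj₂ (_ , eq₁)          | inj₂ (_ , eq₂)          = noPar k k′ t j′ eq₁ eq₂

    runs-move : ∀ j′ t → 𝟙 (runsAt I S′ j′ t) + 𝟙 ⌊ (j′ Finₚ.≟ j) ×-dec (t Finₚ.≟ a) ⌋
                      ≡ 𝟙 (runsAt I S j′ t) + 𝟙 ⌊ (j′ Finₚ.≟ j) ×-dec (t Finₚ.≟ b) ⌋
    runs-move j′ t with (j′ Finₚ.≟ j) ×-dec (t Finₚ.≟ a) | (j′ Finₚ.≟ j) ×-dec (t Finₚ.≟ b)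
    ... | yes (_ , refl)    | yes (_ , t≡b) = contradiction t≡b a≢b
    ... | yes (refl , refl) | no _ =
      trans (cong (_+ 1) (𝟙-¬T ¬runs′-a)) (cong (_+ 0) (sym (𝟙-T (runs⇐ᶠ S fs S[q,a]≡j))))
      where
      ¬runs′-a : ¬ T (runsAt I S′ j a)
      ¬runs′-a r′ with runs⇒ {S′} {j} {a} r′
      ... | k , eq with move-inv {k} {a} {j} eq
      ... | inj₁ (a≡b , _)      = a≢b a≡b
      ... | inj₂ (¬src , eq′) = ¬src (refl , noPar k q a j eq′ S[q,a]≡j)
    ... | no _ | yes (refl , refl) =
      trans (cong (_+ 0) (𝟙-T (runs⇐ {S′} {j} {b} 1≤q′ q′≤m move-at-target))) (cong (_+ 1) (sym (𝟙-¬T ¬runs-b)))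
      where
      move-at-target : S′ q′ b ≡ just j
      move-at-target with (b Finₚ.≟ a) ×-dec (q′ ℕ.≟ q) | (b Finₚ.≟ b) ×-dec (q′ ℕ.≟ q′)
      ... | yes (b≡a , _) | _     = contradiction (sym b≡a) a≢b
      ... | no _          | yes _ = refl
      ... | no _          | no ¬eq = contradiction (refl , refl) ¬eq
    ... | no ¬at-a | no ¬at-b = cong (_+ 0) (𝟙-cong to from)
      where
      to : T (runsAt I S′ j′ t) → T (runsAt I S j′ t)
      to r′ with runs⇒ {S′} {j′} {t} r′
      ... | k , eq with move-inv {k} {t} {j′} eq
      ... | inj₁ (t≡b , _ , j′≡j) = contradiction (j′≡j , t≡b) ¬at-b
      ... | inj₂ (_ , eq′)        = runs⇐ᶠ S fs eq′
      from : T (runsAt I S j′ t) → T (runsAt I S′ j′ t)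
      from r with runs⇒ {S} {j′} {t} r
      ... | k , eq = let 1≤k , k≤m , _ = inRange′ k t j′ eq′ in runs⇐ {S′} {j′} {t} 1≤k k≤m eq′
        where
        eq′ : S′ k t ≡ just j′
        eq′ = move-preserves eq λ (t≡a , j′≡j) → ¬at-a (j′≡j , t≡a)


    move-elsewhere : ∀ {k t} → t ≢ a → t ≢ b → S′ k t ≡ S k t
    move-elsewhere {k} {t} t≢a t≢b with (t Finₚ.≟ a) ×-dec (k ℕ.≟ q) | (t Finₚ.≟ b) ×-dec (k ℕ.≟ q′)
    ... | yes (t≡a , _) | _             = contradiction t≡a t≢a
    ... | no _          | yes (t≡b , _) = contradiction t≡b t≢b
    ... | no _          | no _          = refl

    S′-feasible : Feasible I S′
    S′-feasible = record { inRange = inRange′ ; noPar = noPar′ ; volume = volume′ }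
      where
      volume′ : ∀ j′ → occ I S′ j′ ≡ p j′
      volume′ j′ = trans (+-cancelʳ-≡ (𝟙 ⌊ j′ Finₚ.≟ j ⌋) _ _ (begin
        occ I S′ j′ + 𝟙 ⌊ j′ Finₚ.≟ j ⌋
          ≡⟨ cong₂ _+_ (occ≡∑ S′ j′) (sym (sum-𝟙-×-dec (j′ Finₚ.≟ j) (Finₚ._≟ a) a refl λ _ → id)) ⟩
        ∑[ t < suc d ] 𝟙 (runsAt I S′ j′ t) + ∑[ t < suc d ] 𝟙 ⌊ (j′ Finₚ.≟ j) ×-dec (t Finₚ.≟ a) ⌋
          ≡⟨ ∑-+-cong {f = λ t → 𝟙 (runsAt I S′ j′ t)} {g = λ t → 𝟙 ⌊ (j′ Finₚ.≟ j) ×-dec (t Finₚ.≟ a) ⌋}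
                      {f′ = λ t → 𝟙 (runsAt I S j′ t)} (runs-move j′) ⟩
        ∑[ t < suc d ] 𝟙 (runsAt I S j′ t) + ∑[ t < suc d ] 𝟙 ⌊ (j′ Finₚ.≟ j) ×-dec (t Finₚ.≟ b) ⌋
          ≡⟨ cong₂ _+_ (sym (occ≡∑ S j′)) (sum-𝟙-×-dec (j′ Finₚ.≟ j) (Finₚ._≟ b) b refl λ _ → id) ⟩
        occ I S j′ + 𝟙 ⌊ j′ Finₚ.≟ j ⌋ ∎)) (volume j′)
        where open ≡-Reasoning

    busy-move : ∀ x k → 𝟙 (is-just (S′ k x)) + 𝟙 ⌊ (x Finₚ.≟ a) ×-dec (k ℕ.≟ q) ⌋
                   ≡ 𝟙 (is-just (S k x)) + 𝟙 ⌊ (x Finₚ.≟ b) ×-dec (k ℕ.≟ q′) ⌋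
    busy-move x k with (x Finₚ.≟ a) ×-dec (k ℕ.≟ q) | (x Finₚ.≟ b) ×-dec (k ℕ.≟ q′)
    ... | yes (refl , refl) | yes (a≡b , _) = contradiction a≡b a≢b
    ... | yes (refl , refl) | no _          = cong (λ z → 𝟙 (is-just z) + 0) (sym S[q,a]≡j)
    ... | no _              | yes (refl , refl) = cong (λ z → 𝟙 (is-just z) + 1) (sym S[q′,b]≡nothing)
    ... | no _              | no _          = refl

    vol-move : ∀ x → vol I S′ x + 𝟙 ⌊ x Finₚ.≟ a ⌋ ≡ vol I S x + 𝟙 ⌊ x Finₚ.≟ b ⌋
    vol-move x = begin
      vol I S′ x + 𝟙 ⌊ x Finₚ.≟ a ⌋
        ≡⟨ cong₂ _+_ (vol≡∑ S′ x) (sym (∑-proc q≥1 q≤m (x Finₚ.≟ a))) ⟩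
      ∑[ i < m ] 𝟙 (is-just (S′ (proc i) x)) + ∑[ i < m ] 𝟙 ⌊ (x Finₚ.≟ a) ×-dec (proc i ℕ.≟ q) ⌋
        ≡⟨ ∑-+-cong {f = λ i → 𝟙 (is-just (S′ (proc i) x))} {g = λ i → 𝟙 ⌊ (x Finₚ.≟ a) ×-dec (proc i ℕ.≟ q) ⌋}
                    {f′ = λ i → 𝟙 (is-just (S (proc i) x))} (busy-move x ∘ proc) ⟩
      ∑[ i < m ] 𝟙 (is-just (S (proc i) x)) + ∑[ i < m ] 𝟙 ⌊ (x Finₚ.≟ b) ×-dec (proc i ℕ.≟ q′) ⌋
        ≡⟨ cong₂ _+_ (sym (vol≡∑ S x)) (∑-proc 1≤q′ q′≤m (x Finₚ.≟ b)) ⟩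
      vol I S x + 𝟙 ⌊ x Finₚ.≟ b ⌋ ∎
      where
      open ≡-Reasoning
      q≥1 = proj₁ (inRange q a j S[q,a]≡j)
      q≤m = proj₁ (proj₂ (inRange q a j S[q,a]≡j))
      ∑-proc : ∀ {A : Set} {k} → 1 ≤ k → k ≤ m → (c : Dec A) →
               ∑[ i < m ] 𝟙 ⌊ c ×-dec (proc i ℕ.≟ k) ⌋ ≡ 𝟙 ⌊ c ⌋
      ∑-proc 1≤k k≤m c = let i₀ , proc-i₀ = proc-surjective 1≤k k≤m in
        sum-𝟙-×-dec c (λ i → proc i ℕ.≟ _) i₀ proc-i₀ λ i e → proc-injective (trans e (sym proc-i₀))

  record Vacancy (S S* : Schedule I) (L : Subset (suc d)) (y : Slot I) : Set where
    field
      feasible    : Feasible I S*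
      agrees      : ∀ {x} → x ∈ L → x ≢ y → ∀ k → S* k x ≡ S k x
      jobs-at     : ∀ {k j} → S* k y ≡ just j → T (runsAt I S j y)
      spare       : ℕ
      1≤spare     : 1 ≤ spare
      spare≤m     : spare ≤ m
      spare-idle  : S* spare y ≡ nothing

  vacancy-⊆ : ∀ {S S* L L′ y} → L′ ⊆ L → Vacancy S S* L y → Vacancy S S* L′ y
  vacancy-⊆ L′⊆L vac = record
    { feasible = feasible ; agrees = agrees ∘ L′⊆L ; jobs-at = jobs-at
    ; spare = spare ; 1≤spare = 1≤spare ; spare≤m = spare≤m ; spare-idle = spare-idle }
    where open Vacancy vac

  module _ {S : Schedule I} (fs : Feasible I S) where

    shift-back : ∀ {S* L x y} → Vacancy S S* L y → x ∈ L → y ∉ L → Step S x y →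
                 ∃ λ S′ → Vacancy S S′ L x ×
                          ∀ z → vol I S′ z + 𝟙 ⌊ z Finₚ.≟ x ⌋ ≡ vol I S* z + 𝟙 ⌊ z Finₚ.≟ y ⌋
    shift-back {S*} {L} {x} {y} vac x∈L y∉L (j , runs-x , y∈E , ¬runs-y) =
      M.S′ , vacancy , M.vol-move
      where
      open Vacancy vac
      x≢y : x ≢ y
      x≢y refl = y∉L x∈L
      on-x : ∃ λ k → S* k x ≡ just j
      on-x = let k , eq = runs⇒ {S} runs-x in k , trans (agrees x∈L x≢y k) eq
      ¬runs*-y : ¬ T (runsAt I S* j y)
      ¬runs*-y r* = let k , eq = runs⇒ {S*} r* in ¬runs-y (jobs-at eq)
      q : ℕ
      q = proj₁ on-x
      module M = Move feasible (proj₂ on-x) y∈E ¬runs*-y 1≤spare spare≤m spare-idle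
      vacancy : Vacancy S M.S′ L x
      vacancy = record
        { feasible   = M.S′-feasible
        ; agrees     = λ {x′} x′∈L x′≢x k → trans (M.move-elsewhere x′≢x λ { refl → y∉L x′∈L })
                                                 (agrees x′∈L (λ { refl → y∉L x′∈L }) k)
        ; jobs-at    = λ {k} {j′} eq → jobs-at-x k j′ eq
        ; spare      = q
        ; 1≤spare    = proj₁ (Feasible.inRange feasible q x j (proj₂ on-x))
        ; spare≤m    = proj₁ (proj₂ (Feasible.inRange feasible q x j (proj₂ on-x)))
        ; spare-idle = M.move-at-source
        }
        where
        jobs-at-x : ∀ k j′ → M.S′ k x ≡ just j′ → T (runsAt I S j′ x)
        jobs-at-x k j′ eq with M.move-inv {k} {x} {j′} eq
        ... | inj₁ (x≡y , _) = contradiction x≡y x≢y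
        ... | inj₂ (_ , eq*) = runs⇐ᶠ S fs (trans (sym (agrees x∈L x≢y k)) eq*)

    -- Going back from y through the layers, each move happens at a slot of a lower layer, which no
    -- earlier move has touched.
    shift : ∀ e i {S* y} → y ∈ layer S e i → Vacancy S S* (layer S e i) y →
            ∃ λ S′ → Feasible I S′ ×
                     ∀ z → vol I S′ z + 𝟙 ⌊ z Finₚ.≟ e ⌋ ≡ vol I S* z + 𝟙 ⌊ z Finₚ.≟ y ⌋
    shift e zero {S*} y∈ vac with layer-zero⁻ S {e} y∈
    ... | refl = S* , Vacancy.feasible vac , λ _ → refl
    shift e (suc i) {S*} {y} y∈ vac with y Subₚ.∈? layer S e i | layer-suc⁻ S {e} {y} {i} y∈
    ... | yes y∈′ | _                      = shift e i y∈′ (vacancy-⊆ (layer-⊆-suc S) vac)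
    ... | no _    | inj₁ y∈′               = shift e i y∈′ (vacancy-⊆ (layer-⊆-suc S) vac)
    ... | no y∉   | inj₂ (x , x∈ , x⇝y) =
      let S′ , vac′ , eq′ = shift-back (vacancy-⊆ (layer-⊆-suc S) vac) x∈ y∉ x⇝y
          S″ , fs″ , eq″  = shift e i x∈ vac′
      in  S″ , fs″ , λ z → trans (eq″ z) (eq′ z)

  -- Bounds maintained by PLTR

  upper lower : Bounds I → Slot I → ℕ
  upper = proj₁
  lower = proj₂

  _⊑_ : Bounds I → Bounds I → Set
  B ⊑ B′ = ∀ s → upper B′ s ≤ upper B s × lower B s ≤ lower B′ s

  ⊑-trans : ∀ {B₁ B₂ B₃} → B₁ ⊑ B₂ → B₂ ⊑ B₃ → B₁ ⊑ B₃
  ⊑-trans B₁⊑B₂ B₂⊑B₃ s = ≤-trans (proj₁ (B₂⊑B₃ s)) (proj₁ (B₁⊑B₂ s))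
                        , ≤-trans (proj₂ (B₁⊑B₂ s)) (proj₂ (B₂⊑B₃ s))

  Respects : Bounds I → (Slot I → ℕ) → Set
  Respects B v = ∀ s → lower B s ≤ v s × v s ≤ upper B s

  -- During round k of PLTR every upper bound is at least k − 1, and every lower bound not yet raised
  -- in round k is 0 or at least k + 1.
  UpperFloor : ℕ → Bounds I → Set
  UpperFloor k B = ∀ s → k ∸ 1 ≤ upper B s

  LowerGap : ℕ → ℕ → Bounds I → Set
  LowerGap k t B = ∀ s → t ≤ toℕ s → lower B s ≡ 0 ⊎ k ≤ lower B s

  inRangeB⁻ : ∀ a b s → T (inRangeB I a b s) → a ≤ toℕ s × toℕ s < b
  inRangeB⁻ a b s h with a ℕ.≤? toℕ s | toℕ s ℕ.<? b | h
  ... | yes a≤s | yes s<b | _ = a≤s , s<b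

  inRangeB⁺ : ∀ {a b} s → a ≤ toℕ s → toℕ s < b → T (inRangeB I a b s)
  inRangeB⁺ {a} {b} s a≤s s<b with a ℕ.≤? toℕ s | toℕ s ℕ.<? b
  ... | yes _   | yes _   = _
  ... | no a≰s  | _       = a≰s a≤s
  ... | yes _   | no s≮b  = s≮b s<b

  idle-⊑ : ∀ {k t t′ B} → UpperFloor k B → B ⊑ updIdle I k t t′ B × UpperFloor k (updIdle I k t t′ B)
  idle-⊑ {k} {t} {t′} {B} floor = (λ s → lowered s , ≤-refl) , raised
    where
    lowered : ∀ s → upper (updIdle I k t t′ B) s ≤ upper B s
    lowered s with inRangeB I t t′ s
    ... | true  = floor s
    ... | false = ≤-refl
    raised : UpperFloor k (updIdle I k t t′ B)
    raised s with inRangeB I t t′ s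
    ... | true  = ≤-refl
    ... | false = floor s

  busy-⊑ : ∀ {k t t′ B} → B ⊑ updBusy I k t t′ B
  busy-⊑ {k} {t} {t′} {B} s = ≤-refl , raised
    where
    raised : lower B s ≤ lower (updBusy I k t t′ B) s
    raised with inRangeB I t t′ s
    ... | true  = m≤n⊔m k (lower B s)
    ... | false = ≤-refl

  loop-⊑ : ∀ {k t B B′} → Loop I k t B B′ → UpperFloor k B → B ⊑ B′ × UpperFloor k B′
  loop-⊑ (done _)              floor = (λ _ → ≤-refl , ≤-refl) , floor
  loop-⊑ {k} {t} {B} (step {t₁ = t₁} {t₂} _ _ _ rest) floor =
    let B⊑B₁ , floor₁ = idle-⊑ {k} {t} {t₁} {B} floor
        B₂⊑B′ , floor′ = loop-⊑ rest floor₁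
    in  ⊑-trans B⊑B₁ (⊑-trans (busy-⊑ {k} {t₁} {t₂}) B₂⊑B′) , floor′

  loop-lower : ∀ {k t B B′} → Loop I k t B B′ → LowerGap k 0 B → LowerGap k 0 B′
  loop-lower (done _) gap = gap
  loop-lower {k} {t} (step {t₁ = t₁} {t₂} {B} _ _ _ rest) gap = loop-lower rest gap′
    where
    gap′ : LowerGap k 0 (updBusy I k t₁ t₂ (updIdle I k t t₁ B))
    gap′ s _ with inRangeB I t₁ t₂ s
    ... | true  = inj₂ (m≤m⊔n k (lower B s))
    ... | false = gap s z≤n

  rounds-⊑ : ∀ {K B B′} → Rounds I K B B′ → UpperFloor K B → B ⊑ B′
  rounds-⊑ rzero               _     s = ≤-refl , ≤-refl
  rounds-⊑ (rsuc {K} loop rest) floor =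
    let B⊑B′ , floor′ = loop-⊑ loop floor
    in  ⊑-trans B⊑B′ (rounds-⊑ rest λ s → ≤-trans (∸-monoˡ-≤ 1 (n≤1+n K)) (floor′ s))

  -- For the output of PLTR, processor k is busy at t iff k ≤ vol t, so engagements of k are onsets
  -- (engagement⇒onset).
  Onset : (Slot I → ℕ) → ℕ → Slot I → Set
  Onset v k e = k ≤ v e × ∀ e′ → suc (toℕ e′) ≡ toℕ e → v e′ < k

  previous : ∀ {e : Slot I} → 0 < toℕ e → ∃ λ (e′ : Slot I) → suc (toℕ e′) ≡ toℕ e
  previous {Fin.suc e″} _ = Fin.inject₁ e″ , cong suc (Finₚ.toℕ-inject₁ e″)

  onset-exists : ∀ {v : Slot I → ℕ} {k t} → k ≤ v t → ∃ λ e → Onset v k e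
  onset-exists {v} {k} {t} = go (toℕ t) t refl
    where
    go : ∀ n (t : Slot I) → toℕ t ≡ n → k ≤ v t → ∃ λ e → Onset v k e
    go zero    t t≡0 k≤vt = t , k≤vt , λ _ eq → contradiction (trans eq t≡0) λ ()
    go (suc n) t t≡1+n k≤vt with previous {t} (≤-trans (s≤s z≤n) (≤-reflexive (sym t≡1+n)))
    ... | e′ , e′+1≡t with v e′ ℕ.<? k
    ...   | yes ve′<k = t , k≤vt , λ e″ e″+1≡t →
              subst (λ s → v s < k) (Finₚ.toℕ-injective (suc-injective (trans e′+1≡t (sym e″+1≡t)))) ve′<k
    ...   | no  ve′≮k = go n e′ (suc-injective (trans e′+1≡t t≡1+n)) (≮⇒≥ ve′≮k)

  -- The call KeepIdle(k, start) of the run of PLTR that returned e, and the bounds it started from.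
  record IdleStepEndingAt (k : ℕ) (e : Slot I) (F : Bounds I) : Set where
    field
      start   : ℕ
      before  : Bounds I
      start≤e : start ≤ toℕ e
      maximal : MaxStep I (updIdle I) k start before (toℕ e)
      floor   : UpperFloor k before
      gap     : LowerGap (suc k) start before
      refines : updIdle I k start (toℕ e) before ⊑ F

  module _ {F : Bounds I} {v : Slot I → ℕ} (respects : Respects F v) where

    locate-in-loop : ∀ {k t B B′ e} → Loop I k t B B′ → B′ ⊑ F → UpperFloor k B → LowerGap (suc k) t B →
                     1 ≤ k → t ≤ toℕ e → Onset v k e → IdleStepEndingAt k e F
    locate-in-loop {e = e} (done d<t) _ _ _ _ t≤e _ =
      contradiction (s≤s⁻¹ (Finₚ.toℕ<n e)) (<⇒≱ (<-≤-trans d<t t≤e))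
    locate-in-loop {k} {t} {B} {e = e} (step {t₁ = t₁} {t₂} _ idle-max busy-max rest) B′⊑F floor gap 1≤k t≤e
                   onset@(k≤ve , below) = by-position (<-cmp (toℕ e) t₁)
      where
      B₁ = updIdle I k t t₁ B
      B₂ = updBusy I k t₁ t₂ B₁
      B₂⊑F : B₂ ⊑ F
      B₂⊑F = ⊑-trans (proj₁ (loop-⊑ rest (proj₂ (idle-⊑ {k} {t} {t₁} {B} floor)))) B′⊑F
      B₁⊑F : B₁ ⊑ F
      B₁⊑F = ⊑-trans (busy-⊑ {k} {t₁} {t₂}) B₂⊑F

      by-position : Tri (toℕ e < t₁) (toℕ e ≡ t₁) (t₁ < toℕ e) → IdleStepEndingAt k e F
      by-position (tri< e<t₁ _ _) = contradiction (begin
          k                                 ≤⟨ k≤ve ⟩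
          v e                               ≤⟨ proj₂ (respects e) ⟩
          upper F e                         ≤⟨ proj₁ (B₁⊑F e) ⟩
          upper B₁ e                        ≡⟨ if-T (inRangeB⁺ e t≤e e<t₁) ⟩
          k ∸ 1                             ∎) (<⇒≱ (∸-monoʳ-< (s≤s z≤n) 1≤k))
        where open ≤-Reasoning
      by-position (tri≈ _ e≡t₁ _) = record
        { start = t ; before = B ; start≤e = t≤e ; floor = floor ; gap = gap
        ; maximal = subst (MaxStep I (updIdle I) k t B) (sym e≡t₁) idle-max
        ; refines = subst (λ t′ → updIdle I k t t′ B ⊑ F) (sym e≡t₁) B₁⊑F }
      by-position (tri> _ _ t₁<e) with toℕ e ℕ.<? t₂
      ... | no e≮t₂ =
        locate-in-loop rest B′⊑F (proj₂ (idle-⊑ {k} {t} {t₁} {B} floor)) gap₂ 1≤k (≮⇒≥ e≮t₂) onset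
        where
        gap₂ : LowerGap (suc k) t₂ B₂
        gap₂ s t₂≤s with inRangeB I t₁ t₂ s in eq
        ... | true  = contradiction t₂≤s (<⇒≱ (proj₂ (inRangeB⁻ t₁ t₂ s (subst T (sym eq) _))))
        ... | false = gap s (≤-trans (≤-trans (proj₁ idle-max) (proj₁ busy-max)) t₂≤s)
      ... | yes e<t₂ = contradiction (begin
          k                   ≤⟨ m≤m⊔n k _ ⟩
          k ⊔ lower B₁ e′      ≡⟨ sym (if-T (inRangeB⁺ e′ t₁≤e′ (<-trans (≤-reflexive e′+1≡e) e<t₂))) ⟩
          lower B₂ e′          ≤⟨ proj₂ (B₂⊑F e′) ⟩
          lower F e′           ≤⟨ proj₁ (respects e′) ⟩
          v e′                 ∎) (<⇒≱ (below e′ e′+1≡e))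
        where
        open ≤-Reasoning
        e′ = proj₁ (previous (≤-<-trans z≤n t₁<e))
        e′+1≡e = proj₂ (previous (≤-<-trans z≤n t₁<e))
        t₁≤e′ : t₁ ≤ toℕ e′
        t₁≤e′ = s≤s⁻¹ (≤-trans t₁<e (≤-reflexive (sym e′+1≡e)))

    locate : ∀ {K B} → Rounds I K B F → UpperFloor K B → LowerGap (suc K) 0 B →
             ∀ {k e} → 1 ≤ k → k ≤ K → Onset v k e → IdleStepEndingAt k e F
    locate rzero _ _ 1≤k k≤0 _ = contradiction (≤-trans 1≤k k≤0) λ ()
    locate (rsuc {K} loop rest) floor gap {k} 1≤k k≤1+K onset with k ℕ.≟ suc K
    ... | yes refl = locate-in-loop loop (rounds-⊑ rest floor′) floor gap 1≤k z≤n onset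
      where floor′ = λ s → ≤-trans (∸-monoˡ-≤ 1 (n≤1+n K)) (proj₂ (loop-⊑ loop floor) s)
    ... | no  k≢1+K = locate rest floor′ (loop-lower loop λ s _ → Sum.map₂ (≤-trans (n≤1+n _)) (gap s z≤n))
                        1≤k (s≤s⁻¹ (≤∧≢⇒< k≤1+K k≢1+K)) onset
      where floor′ = λ s → ≤-trans (∸-monoˡ-≤ 1 (n≤1+n K)) (proj₂ (loop-⊑ loop floor) s)

  busy-bounds : ∀ {S k t} → Feasible I S → S k t ≢ nothing → 1 ≤ k × k ≤ m
  busy-bounds {S} {k} {t} fs busy with S k t in eq
  ... | nothing = contradiction refl busy
  ... | just j  = let 1≤k , k≤m , _ = Feasible.inRange fs k t j eq in 1≤k , k≤m

  vol≤m : ∀ S t → vol I S t ≤ m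
  vol≤m S t = ≤-trans (≤-reflexive (vol≡∑ S t)) (sum-𝟙≤ λ i → is-just (S (proc i) t))

  module _ {S : Schedule I} (fs : Feasible I S)
           (lowest : ∀ k k′ t → 1 ≤ k → k < k′ → S k′ t ≢ nothing → S k t ≢ nothing) where

    busy⇒≤vol : ∀ {k t} → S k t ≢ nothing → k ≤ vol I S t
    busy⇒≤vol {k} {t} busy = begin
      k                                       ≡⟨ sym (m≤n⇒m⊓n≡m (proj₂ (busy-bounds fs busy))) ⟩
      k ⊓ m                                   ≡⟨ ⊓-comm k m ⟩
      m ⊓ k                                   ≡⟨ sym (sum-𝟙-<ᵇ m k) ⟩
      ∑[ i < m ] 𝟙 (toℕ i <ᵇ k)               ≤⟨ sum-mono-≤ (𝟙-mono ∘ busy-below) ⟩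
      ∑[ i < m ] 𝟙 (is-just (S (proc i) t))   ≡⟨ sym (vol≡∑ S t) ⟩
      vol I S t                               ∎
      where
      open ≤-Reasoning
      busy-below : ∀ i → T (toℕ i <ᵇ k) → T (is-just (S (proc i) t))
      busy-below i i<ᵇk with m≤n⇒m<n∨m≡n {proc i} {k} (<ᵇ⇒< (toℕ i) k i<ᵇk)
      ... | inj₁ proc-i<k = is-just⁺ (lowest (proc i) k t (s≤s z≤n) proc-i<k busy)
      ... | inj₂ refl     = is-just⁺ busy

    idle⇒vol< : ∀ {k t} → 1 ≤ k → S k t ≡ nothing → vol I S t < k
    idle⇒vol< {k} {t} 1≤k idle = begin-strict
      vol I S t                               ≡⟨ vol≡∑ S t ⟩
      ∑[ i < m ] 𝟙 (is-just (S (proc i) t))   ≤⟨ sum-mono-≤ (λ i → 𝟙-mono (<⇒<ᵇ ∘ busy⇒below i ∘ is-just⁻)) ⟩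
      ∑[ i < m ] 𝟙 (toℕ i <ᵇ (k ∸ 1))         ≡⟨ sum-𝟙-<ᵇ m (k ∸ 1) ⟩
      m ⊓ (k ∸ 1)                             ≤⟨ m⊓n≤n m (k ∸ 1) ⟩
      k ∸ 1                                   <⟨ ∸-monoʳ-< (s≤s z≤n) 1≤k ⟩
      k                                       ∎
      where
      open ≤-Reasoning
      busy⇒below : ∀ i → S (proc i) t ≢ nothing → toℕ i < k ∸ 1
      busy⇒below i busy with <-cmp (proc i) k
      ... | tri< proc-i<k _ _ = ∸-monoˡ-≤ 1 proc-i<k
      ... | tri≈ _ refl _     = contradiction idle busy
      ... | tri> _ _ k<proc-i = contradiction idle (lowest k (proc i) t 1≤k k<proc-i busy)

    engagement⇒onset : ∀ {k t} → 1 ≤ k → Engagement I S k t → Onset (vol I S) k t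
    engagement⇒onset {k} {t} 1≤k (b , t≤b , b≤d , all-busy , maximal) =
      busy⇒≤vol (all-busy t ≤-refl t≤b) , λ e′ e′+1≡t → idle⇒vol< 1≤k (idle-before e′ e′+1≡t)
      where
      idle-before : ∀ e′ → suc (toℕ e′) ≡ toℕ t → S k e′ ≡ nothing
      idle-before e′ e′+1≡t with S k e′ in eq
      ... | nothing = refl
      ... | just _  = contradiction (proj₁ (maximal (toℕ e′) b e′≤t ≤-refl b≤d busy′)) (<⇒≢ (≤-reflexive e′+1≡t))
        where
        e′≤t : toℕ e′ ≤ toℕ t
        e′≤t = ≤-trans (n≤1+n _) (≤-reflexive e′+1≡t)
        busy′ : AllBusy I S k (toℕ e′) b
        busy′ s e′≤s s≤b with toℕ s ℕ.≟ toℕ e′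
        ... | yes s≡e′ = λ idle → contradiction (trans (sym eq) (trans (cong (S k) (sym (Finₚ.toℕ-injective s≡e′))) idle))
                                                λ ()
        ... | no  s≢e′ = all-busy s (≤-trans (≤-reflexive (sym e′+1≡t)) (≤∧≢⇒< e′≤s (s≢e′ ∘ sym))) s≤b

    vol<⇒idle : ∀ {k t} → vol I S t < k → S k t ≡ nothing
    vol<⇒idle {k} {t} vol<k with S k t in eq
    ... | nothing = refl
    ... | just _  = contradiction (busy⇒≤vol {k} {t} λ idle → contradiction (trans (sym eq) idle) λ ()) (<⇒≱ vol<k)

  module _ (S : Schedule I) where

    busy? : ∀ k s → Dec (Busy I S k s)
    busy? k s = ¬? (Maybeₚ.≡-dec Finₚ._≟_ (S k s) nothing)

    allBusy? : ∀ k a b → Dec (AllBusy I S k a b)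
    allBusy? k a b = Finₚ.all? λ s → a ℕ.≤? toℕ s →-dec toℕ s ℕ.≤? b →-dec busy? k s

    unextendable? : ∀ k a b →
      Dec (∀ a′ b′ → a′ ≤ a → b ≤ b′ → b′ ≤ d → AllBusy I S k a′ b′ → a′ ≡ a × b′ ≡ b)
    unextendable? k a b = map′
      (λ h a′ b′ a′≤a b≤b′ b′≤d → h (s≤s a′≤a) (s≤s b′≤d) b≤b′)
      (λ h {a′} a′<1+a {b′} b′<1+d b≤b′ → h a′ b′ (s≤s⁻¹ a′<1+a) b≤b′ (s≤s⁻¹ b′<1+d))
      (allUpTo? (λ a′ → allUpTo? (λ b′ → b ℕ.≤? b′ →-dec allBusy? k a′ b′ →-dec a′ ℕ.≟ a ×-dec b′ ℕ.≟ b)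
                                  (suc d))
                (suc a))

    engagement? : ∀ k t → Dec (Engagement I S k t)
    engagement? k t = map′
      (λ (b , _ , interval) → b , interval)
      (λ (b , interval) → b , s≤s (proj₁ (proj₂ interval)) , interval)
      (anyUpTo? (λ b → toℕ t ℕ.≤? b ×-dec b ℕ.≤? d ×-dec allBusy? k (toℕ t) b ×-dec unextendable? k (toℕ t) b)
                (suc d))

    above? : ∀ g C → Dec (Above I S g C)
    cond?  : ∀ g C → Dec (Cond I S g C)
    crit?  : ∀ g C → Dec (Crit I S g C)

    above? zero    C = yes _
    above? (suc g) C = allSubsets? (λ C′ → crit? g C′ →-dec C′ Subₚ.⊆? C) ×-dec above? g C

    cond? g C = above? g C
      ×-dec Finₚ.all? (λ t → engagement? (m ∸ g) t →-dec t Subₚ.∈? C)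
      ×-dec fv I C ℕ.≟ volSet I S C
      ×-dec Finₚ.all? (λ t → t Subₚ.∈? C →-dec (m ∸ g) ∸ 1 ℕ.≤? vol I S t)

    crit? g C = cond? g C ×-dec Subₚ.nonempty? C
      ×-dec allSubsets? λ C′ → cond? g C′ →-dec Subₚ.nonempty? C′
                               →-dec fv I C′ * ∣ C ∣ ℕ.≤? fv I C * ∣ C′ ∣

  module Transfer {v v′ : Slot I → ℕ} {e y : Slot I} (y≢e : y ≢ e)
                  (transfer : ∀ z → v′ z + 𝟙 ⌊ z Finₚ.≟ e ⌋ ≡ v z + 𝟙 ⌊ z Finₚ.≟ y ⌋) where

    at-e : suc (v′ e) ≡ v e
    at-e with e Finₚ.≟ e | e Finₚ.≟ y | transfer e
    ... | no e≢e | _       | _  = contradiction refl e≢e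
    ... | yes _  | yes e≡y | _  = contradiction (sym e≡y) y≢e
    ... | yes _  | no _    | eq = trans (+-comm 1 _) (trans eq (+-identityʳ _))

    off-e : ∀ {s} → s ≢ e → v′ s ≡ v s + 𝟙 ⌊ s Finₚ.≟ y ⌋
    off-e {s} s≢e with s Finₚ.≟ e | transfer s
    ... | yes s≡e | _  = contradiction s≡e s≢e
    ... | no _    | eq = trans (sym (+-identityʳ _)) eq

    ≥-off-e : ∀ {s} → s ≢ e → v s ≤ v′ s
    ≥-off-e s≢e = ≤-trans (m≤m+n _ _) (≤-reflexive (sym (off-e s≢e)))

    ≤-off-e : ∀ {s X} → s ≢ e → v s ≤ X → suc (v y) ≤ X → v′ s ≤ X
    ≤-off-e {s} s≢e vs≤X vy<X with s Finₚ.≟ y | off-e s≢e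
    ... | yes refl | eq = ≤-trans (≤-reflexive (trans eq (+-comm _ 1))) vy<X
    ... | no  _    | eq = ≤-trans (≤-reflexive (trans eq (+-identityʳ _))) vs≤X

  module _ {F : Bounds I} (pltr : PLTR I F) {S : Schedule I} (out : Output I F S) where

    private
      fs       = proj₁ out
      respects : Respects F (vol I S)
      respects = proj₁ (proj₂ out)
      lowest   = proj₂ (proj₂ out)

    longer-idle-step : ∀ {k e y} (idle-step : IdleStepEndingAt k e F) → vol I S e ≡ k → suc (vol I S y) ≤ k ∸ 1 →
      ∀ {S′} → (∀ z → vol I S′ z + 𝟙 ⌊ z Finₚ.≟ e ⌋ ≡ vol I S z + 𝟙 ⌊ z Finₚ.≟ y ⌋) →
      Respects (updIdle I k (IdleStepEndingAt.start idle-step) (suc (toℕ e)) (IdleStepEndingAt.before idle-step)) (vol I S′)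
    longer-idle-step {k} {e} {y} idle-step ve≡k vy<k-1 {S′} vol′ s = lower-ok , upper-ok
      where
      open IdleStepEndingAt idle-step
      y≢e : y ≢ e
      y≢e refl = <⇒≱ (≤-trans vy<k-1 (m∸n≤m k 1)) (≤-reflexive (sym ve≡k))
      open Transfer y≢e vol′
      lower-ok : lower before s ≤ vol I S′ s
      lower-ok with s Finₚ.≟ e
      ... | no s≢e = ≤-trans (proj₂ (refines s)) (≤-trans (proj₁ (respects s))
                       (≥-off-e s≢e))
      ... | yes refl with gap s start≤e
      ...   | inj₁ zero-lower = ≤-trans (≤-reflexive zero-lower) z≤n
      ...   | inj₂ k<lower    =
        contradiction (≤-trans (proj₂ (refines s)) (≤-trans (proj₁ (respects s)) (≤-reflexive ve≡k))) (<⇒≱ k<lower)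
      upper-ok : vol I S′ s ≤ upper (updIdle I k start (suc (toℕ e)) before) s
      upper-ok with T? (inRangeB I start (suc (toℕ e)) s) | s Finₚ.≟ e
      ... | yes in-range | yes refl =
        subst (vol I S′ s ≤_) (sym (if-T in-range)) (≤-reflexive (cong (_∸ 1) (trans at-e ve≡k)))
      ... | yes in-range | no s≢e   = subst (vol I S′ s ≤_) (sym (if-T in-range))
          (≤-off-e s≢e (≤-trans (proj₂ (respects s)) (≤-trans (proj₁ (refines s)) (≤-reflexive (if-T before-e)))) vy<k-1)
        where
        before-e : T (inRangeB I start (toℕ e) s)
        before-e = let start≤s , s<e+1 = inRangeB⁻ start (suc (toℕ e)) s in-range
                   in inRangeB⁺ s start≤s (≤∧≢⇒< (s≤s⁻¹ s<e+1) (s≢e ∘ Finₚ.toℕ-injective))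
      ... | no out-of-range | _ = subst (vol I S′ s ≤_) (sym (if-¬T out-of-range))
          (≤-off-e s≢e (≤-trans (proj₂ (respects s)) (≤-trans (proj₁ (refines s)) (≤-reflexive (if-¬T ¬before-e))))
                       (≤-trans vy<k-1 (floor s)))
        where
        s≢e : s ≢ e
        s≢e refl = out-of-range (inRangeB⁺ e start≤e ≤-refl)
        ¬before-e : ¬ T (inRangeB I start (toℕ e) s)
        ¬before-e h = let start≤s , s<e = inRangeB⁻ start (toℕ e) s h
                      in out-of-range (inRangeB⁺ s start≤s (≤-trans s<e (n≤1+n _)))

    reach-from-onset : ∀ {k e y} → 1 ≤ k → Onset (vol I S) k e → y ∈ reach S e → k ∸ 1 ≤ vol I S y
    reach-from-onset {k} {e} {y} 1≤k (k≤ve , below) y∈ =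
      ≤-trans (∸-monoˡ-≤ 1 k≤ve) (decidable-stable (_ ℕ.≤? _) (not-maximal ∘ ≰⇒>))
      where
      onset′ : Onset (vol I S) (vol I S e) e
      onset′ = ≤-refl , λ e′ e′+1≡e → <-≤-trans (below e′ e′+1≡e) k≤ve
      not-maximal : suc (vol I S y) ≤ vol I S e ∸ 1 → ⊥
      not-maximal vy<ve-1 =
        let S′ , fs′ , vol′ = shift fs e (suc d) y∈ vacancy
        in  cannot-extend (suc (toℕ e)) ≤-refl (Finₚ.toℕ<n e) (S′ , fs′ , longer-idle-step idle-step refl vy<ve-1 vol′)
        where
        idle-step = locate respects pltr (λ _ → m∸n≤m m 1) (λ _ _ → inj₁ refl) (≤-trans 1≤k k≤ve) (vol≤m S e)
                           onset′
        open IdleStepEndingAt idle-step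
        cannot-extend = proj₂ (proj₂ (proj₂ maximal))
        vacancy : Vacancy S S (reach S e) y
        vacancy = record
          { feasible = fs ; agrees = λ _ _ _ → refl ; jobs-at = runs⇐ᶠ S fs
          ; spare = suc (vol I S y) ; 1≤spare = s≤s z≤n
          ; spare≤m = ≤-trans vy<ve-1 (≤-trans (m∸n≤m _ 1) (vol≤m S e))
          ; spare-idle = vol<⇒idle fs lowest ≤-refl }

    -- The critical set

    reach-high? : ℕ → Slot I → Bool
    reach-high? k x = ⌊ Finₚ.all? (λ y → y Subₚ.∈? reach S x →-dec k ∸ 1 ℕ.≤? vol I S y) ⌋

    C* : ℕ → Subset (suc d)
    C* k = tabulate (reach-high? k)

    ∈C*⁻ : ∀ {k x y} → x ∈ C* k → y ∈ reach S x → k ∸ 1 ≤ vol I S y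
    ∈C*⁻ {k} {x} {y} x∈ = toWitness (subst T (Vecₚ.lookup∘tabulate (reach-high? k) x) (∈⇒T x∈)) y

    ∈C*⁺ : ∀ {k x} → (∀ {y} → y ∈ reach S x → k ∸ 1 ≤ vol I S y) → x ∈ C* k
    ∈C*⁺ {k} {x} high = T⇒∈ (subst T (sym (Vecₚ.lookup∘tabulate (reach-high? k) x)) (fromWitness λ y → high))

    C*-closed : ∀ {k} → Closed S (C* k)
    C*-closed {k} {x} {y} x∈ x⇝y =
      ∈C*⁺ {k} (∈C*⁻ {k} x∈ ∘ reach-least S (reach-closed S x) (reach-closed S x (x∈reach S x) x⇝y))

    C*-level : ∀ {k t} → t ∈ C* k → k ∸ 1 ≤ vol I S t
    C*-level {k} {t} t∈ = ∈C*⁻ {k} t∈ (x∈reach S t)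

    closed-level⊆C* : ∀ {k Q} → Closed S Q → (∀ {t} → t ∈ Q → k ∸ 1 ≤ vol I S t) → Q ⊆ C* k
    closed-level⊆C* {k} closed high x∈Q = ∈C*⁺ {k} (high ∘ reach-least S closed x∈Q)

    onset∈C* : ∀ {k e} → 1 ≤ k → Onset (vol I S) k e → e ∈ C* k
    onset∈C* {k} 1≤k onset = ∈C*⁺ {k} (reach-from-onset 1≤k onset)

    C*-cond : ∀ {g} → 1 ≤ m ∸ g → Cond I S g (C* (m ∸ g))
    C*-cond {g} 1≤k = above g ≤-refl
                    , (λ _ engaged → onset∈C* 1≤k (engagement⇒onset fs lowest 1≤k engaged))
                    , closed⇒tight S fs (C*-closed {m ∸ g})
                    , (λ _ t∈ → C*-level {m ∸ g} t∈)
      where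
      above : ∀ g′ → g′ ≤ g → Above I S g′ (C* (m ∸ g))
      above zero     _    = _
      above (suc g′) g′<g = (λ C′ ((_ , _ , tight , level) , _) →
                              closed-level⊆C* {m ∸ g} {C′} (tight⇒closed S fs {C′} tight)
                                (≤-trans (∸-monoˡ-≤ 1 (∸-monoʳ-≤ m (<⇒≤ g′<g))) ∘ level _))
                          , above g′ (<⇒≤ g′<g)

    C*-nonempty : ∀ {k} → 1 ≤ k → (∃ λ t → Busy I S k t) → Nonempty (C* k)
    C*-nonempty 1≤k (_ , busy) = let e , onset = onset-exists (busy⇒≤vol fs lowest busy) in e , onset∈C* 1≤k onset

    Admissible : ℕ → Subset (suc d) → Set
    Admissible g C = Cond I S g C × Nonempty C

    critical-set-exists : ∀ g → 1 ≤ m ∸ g → (∃ λ t → Busy I S (m ∸ g) t) → ∃ λ C → Crit I S g C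
    critical-set-exists g 1≤k busy =
      densest (maximum-or-empty {_≼_ = DensLe I S} (λ C → cond? S g C ×-dec Subₚ.nonempty? C) total
                                λ {C} {C′} {C″} → transitive {C} {C′} {C″})
      where
      total : ∀ {C C′} → Admissible g C → Admissible g C′ → DensLe I S C C′ ⊎ DensLe I S C′ C
      total {C} {C′} _ _ = ≤-total (fv I C * ∣ C′ ∣) (fv I C′ * ∣ C ∣)
      transitive : ∀ {C C′ C″} → Admissible g C′ → DensLe I S C C′ → DensLe I S C′ C″ → DensLe I S C C″
      transitive {C} {C′} {C″} (_ , nonempty) =
        cross-≤-trans {fv I C} {fv I C′} {fv I C″} {∣ C ∣} {∣ C′ ∣} {∣ C″ ∣} (nonempty⇒1≤∣∣ nonempty)
      densest : Maximum (Admissible g) (DensLe I S) ⊎ (∀ C → ¬ Admissible g C) → ∃ λ C → Crit I S g C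
      densest (inj₁ (C , (cond , nonempty) , max)) = C , cond , nonempty , λ C′ cond′ nonempty′ → max C′ (cond′ , nonempty′)
      densest (inj₂ none) = contradiction (C*-cond 1≤k , C*-nonempty 1≤k busy) (none (C* (m ∸ g)))

lemma6 : (I : Instance) → FeasibleInstance I →
    (B : Bounds I) → PLTR I B →
    (S : Schedule I) → Output I B S →
    (k : ℕ) → 1 ≤ k → k ≤ Instance.m I →
    (∃ λ t → Busy I S k t) →
    ∃ λ (C : Subset (suc (Instance.d I))) → CriticalSet I S k C
lemma6 I _ B pltr S out k 1≤k k≤m (t , busy) =
  critical-set-exists I pltr out (m ∸ k) (subst (1 ≤_) (sym m∸[m∸k]≡k) 1≤k)
                                         (t , subst (λ k′ → Busy I S k′ t) (sym m∸[m∸k]≡k) busy)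
  where
  m = Instance.m I
  m∸[m∸k]≡k = m∸[m∸n]≡n k≤m
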